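{- For every QCL-formula $F$ and every interpretation $\mathcal{I}\subseteq\mathcal{U}$, the value of the game $\mathbf{G}(\mathbf{P}:F,\mathcal{I})$ (defined in the context) is equal to the QCL satisfaction degree $\mathrm{deg}_\mathcal{I}(F)$.
   Context: QCL-formulas are built from propositional variables (from an infinite set $\mathcal{U}$) using $\neg$, $\wedge$, $\vee$ and the binary connective $\vec{\times}$ (ordered disjunction). Optionality: $\mathrm{opt}(a)=1$; $\mathrm{opt}(\neg F)=1$; $\mathrm{opt}(F\circ G)=\max(\mathrm{opt}(F),\mathrm{opt}(G))$ for $\circ\in\{\wedge,\vee\}$; $\mathrm{opt}(F\vec{\times}G)=\mathrm{opt}(F)+\mathrm{opt}(G)$. An interpretation is a set $\mathcal{I}\subseteq\mathcal{U}$. Satisfaction degree (values in $\mathbb{N}\cup\{\infty\}$): $\mathrm{deg}_\mathcal{I}(a)=1$ if $a\in\mathcal{I}$, $\infty$ otherwise; $\mathrm{deg}_\mathcal{I}(\neg F)=1$ if $\mathrm{deg}_\mathcal{I}(F)=\infty$, $\infty$ otherwise; $\mathrm{deg}_\mathcal{I}(F\wedge G)=\max(\mathrm{deg}_\mathcal{I}(F),\mathrm{deg}_\mathcal{I}(G))$; $\mathrm{deg}_\mathcal{I}(F\vee G)=\min(\mathrm{deg}_\mathcal{I}(F),\mathrm{deg}_\mathcal{I}(G))$; $\mathrm{deg}_\mathcal{I}(F\vec{\times}G)=\mathrm{deg}_\mathcal{I}(F)$ if $\mathrm{deg}_\mathcal{I}(F)<\infty$, $=\mathrm{opt}(F)+\mathrm{deg}_\mathcal{I}(G)$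 if $\mathrm{deg}_\mathcal{I}(F)=\infty$ and $\mathrm{deg}_\mathcal{I}(G)<\infty$, and $=\infty$ otherwise. The game $\mathbf{G}(\mathbf{P}:F,\mathcal{I})$ is played between two players, Me and You. Game trees: nodes are game states $\mathbf{Q}:H$ with $\mathbf{Q}\in\{\mathbf{P},\mathbf{O}\}$ (Me acting as proponent resp. opponent); write $\bar{\mathbf{P}}=\mathbf{O}$, $\bar{\mathbf{O}}=\mathbf{P}$. $T(\mathbf{Q}:a)$ is a single leaf $\mathbf{Q}:a$. $T(\mathbf{Q}:\neg G)$ has root $\mathbf{Q}:\neg G$ with single immediate subtree $T(\bar{\mathbf{Q}}:G)$. For $\circ\in\{\wedge,\vee,\vec{\times}\}$, $T(\mathbf{Q}:G_1\circ G_2)$ has root $\mathbf{Q}:G_1\circ G_2$ with immediate subtrees $T(\mathbf{Q}:G_1)$, $T(\mathbf{Q}:G_2)$. At a node $\mathbf{P}:G_1\wedge G_2$ You choose the successor, at $\mathbf{P}:G_1\vee G_2$ and $\mathbf{P}:G_1\vec{\times}G_2$ I choose; at $\mathbf{O}:G_1\wedge G_2$ I choose, at $\mathbf{O}:G_1\vee G_2$ and $\mathbf{O}:G_1\vec{\times}G_2$ You choose (negation nodes have a single successor). Leaves are outcomes. Preference relation on outcomes: $\ll_{\mathbf{P}:a}=\emptyset$; $\ll_{\mathbf{P}:\neg G}=\emptyset$; $\ll_{\mathbf{P}:G_1\wedge G_2}=\ll_{\mathbf{P}:G_1\vee G_2}=\ll_{\mathbf{P}:G_1}\cup\ll_{\mathbf{P}:G_2}$;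 $O_1\ll_{\mathbf{P}:G_1\vec{\times}G_2}O_2$ iff ($O_1$ is a leaf of $T(\mathbf{P}:G_2)$ and $O_2$ is a leaf of $T(\mathbf{P}:G_1)$) or $O_1\ll_{\mathbf{P}:G_j}O_2$ for some $j$; $\ll_{\mathbf{O}:H}=\emptyset$ for all $H$. Let $\ll=\ll_{\mathbf{P}:F}$. A leaf $\mathbf{P}:a$ is true iff $a\in\mathcal{I}$, a leaf $\mathbf{O}:a$ is true iff $a\notin\mathcal{I}$. For an outcome $O$, let $|\pi_\ll(O)|$ be the maximal $n$ such that there are pairwise distinct outcomes $O=O_1,\dots,O_n$ with $O_i\ll O_{i+1}$ for all $i<n$. Payoff: $d(O)=|\pi_\ll(O)|$ if $O$ is true and $d(O)=\infty$ if $O$ is false, with values in $\mathbb{N}\cup\{\infty\}$ ordered by $\preceq$, the inverse of the natural order (so $1$ is best for Me and $\infty$ worst). A strategy for Me is a set $\sigma$ of nodes containing the root such that for every $v\in\sigma$: if I choose at $v$ then at least one successor of $v$ is in $\sigma$, and if You choose at $v$ (or $v$ has a single successor) then all successors are in $\sigma$; strategies for You are defined symmetrically. Each pair $(\sigma_I,\sigma_Y)$ determines a unique outcome, with payoff $d(\sigma_I,\sigma_Y)$. The value of the game is $\max^{\preceq}_{\sigma_I}\min^{\preceq}_{\sigma_Y} d(\sigma_I,\sigma_Y)$ (which equals the corresponding minmax). -}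

module Defs where

open import Data.Nat using (ℕ; zero; suc; _+_; _≤_; _⊔_; _⊓_)
open import Data.Bool using (Bool; true; false; if_then_else_)
open import Data.Product using (_×_; Σ; ∃; _,_)
open import Data.Sum using (_⊎_)
open import Data.Unit using (⊤)
open import Data.Empty using (⊥)
open import Data.List using (List; []; _∷_; length)
open import Data.List.Relation.Unary.Unique.Propositional using (Unique)
open import Relation.Binary.PropositionalEquality using (_≡_)
open import Relation.Nullary using (¬_)

-- Propositional variables: the infinite set 𝒰 is represented by ℕ.
Var : Set
Var = ℕ

data Fm : Set where
  var  : Var → Fm
  ¬'_  : Fm → Fm
  _∧'_ : Fm → Fm → Fm
  _∨'_ : Fm → Fm → Fm
  _×⃗_  : Fm → Fm → Fm

-- Interpretations: subsets of 𝒰 given by their characteristic function.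
Interp : Set
Interp = Var → Bool

data ℕ∞ : Set where
  fin : ℕ → ℕ∞
  ∞   : ℕ∞

-- natural order on ℕ ∪ {∞} (the paper's ≼ is its inverse)
data _≤∞_ : ℕ∞ → ℕ∞ → Set where
  fin≤fin : ∀ {m n} → m ≤ n → fin m ≤∞ fin n
  ≤∞-top  : ∀ {x} → x ≤∞ ∞

max∞ : ℕ∞ → ℕ∞ → ℕ∞
max∞ (fin m) (fin n) = fin (m ⊔ n)
max∞ (fin m) ∞ = ∞
max∞ ∞ y = ∞

min∞ : ℕ∞ → ℕ∞ → ℕ∞
min∞ (fin m) (fin n) = fin (m ⊓ n)
min∞ (fin m) ∞ = fin m
min∞ ∞ y = y

opt : Fm → ℕ
opt (var a) = 1
opt (¬' F) = 1
opt (F ∧' G) = opt F ⊔ opt G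
opt (F ∨' G) = opt F ⊔ opt G
opt (F ×⃗ G) = opt F + opt G

deg : Interp → Fm → ℕ∞
deg I (var a) = if I a then fin 1 else ∞
deg I (¬' F) with deg I F
... | ∞ = fin 1
... | fin _ = ∞
deg I (F ∧' G) = max∞ (deg I F) (deg I G)
deg I (F ∨' G) = min∞ (deg I F) (deg I G)
deg I (F ×⃗ G) with deg I F | deg I G
... | fin k | _ = fin k
... | ∞ | fin k = fin (opt F + k)
... | ∞ | ∞ = ∞

-- roles: 𝐏 (Me as proponent), 𝐎 (Me as opponent)
data Role : Set where
  𝐏 𝐎 : Role

flip : Role → Role
flip 𝐏 = 𝐎
flip 𝐎 = 𝐏

-- Leaves (outcomes) of the game tree T(Q:F), given as paths from the root.
data Leaf : Role → Fm → Set where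
  atom : ∀ {Q a} → Leaf Q (var a)
  neg  : ∀ {Q F} → Leaf (flip Q) F → Leaf Q (¬' F)
  ∧l   : ∀ {Q F G} → Leaf Q F → Leaf Q (F ∧' G)
  ∧r   : ∀ {Q F G} → Leaf Q G → Leaf Q (F ∧' G)
  ∨l   : ∀ {Q F G} → Leaf Q F → Leaf Q (F ∨' G)
  ∨r   : ∀ {Q F G} → Leaf Q G → Leaf Q (F ∨' G)
  ×l   : ∀ {Q F G} → Leaf Q F → Leaf Q (F ×⃗ G)
  ×r   : ∀ {Q F G} → Leaf Q G → Leaf Q (F ×⃗ G)

-- Strategies for Me on T(Q:F): at my choice nodes I pick one successor,
-- at Your choice nodes (and negation nodes) I must cover all successors.
-- I choose at P:∨, P:×⃗, O:∧; You choose at P:∧, O:∨, O:×⃗.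
MyStrat : Role → Fm → Set
YourStrat : Role → Fm → Set

MyStrat Q (var a) = ⊤
MyStrat Q (¬' F) = MyStrat (flip Q) F
MyStrat 𝐏 (F ∧' G) = MyStrat 𝐏 F × MyStrat 𝐏 G
MyStrat 𝐏 (F ∨' G) = MyStrat 𝐏 F ⊎ MyStrat 𝐏 G
MyStrat 𝐏 (F ×⃗ G) = MyStrat 𝐏 F ⊎ MyStrat 𝐏 G
MyStrat 𝐎 (F ∧' G) = MyStrat 𝐎 F ⊎ MyStrat 𝐎 G
MyStrat 𝐎 (F ∨' G) = MyStrat 𝐎 F × MyStrat 𝐎 G
MyStrat 𝐎 (F ×⃗ G) = MyStrat 𝐎 F × MyStrat 𝐎 G

YourStrat Q (var a) = ⊤
YourStrat Q (¬' F) = YourStrat (flip Q) F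
YourStrat 𝐏 (F ∧' G) = YourStrat 𝐏 F ⊎ YourStrat 𝐏 G
YourStrat 𝐏 (F ∨' G) = YourStrat 𝐏 F × YourStrat 𝐏 G
YourStrat 𝐏 (F ×⃗ G) = YourStrat 𝐏 F × YourStrat 𝐏 G
YourStrat 𝐎 (F ∧' G) = YourStrat 𝐎 F × YourStrat 𝐎 G
YourStrat 𝐎 (F ∨' G) = YourStrat 𝐎 F ⊎ YourStrat 𝐎 G
YourStrat 𝐎 (F ×⃗ G) = YourStrat 𝐎 F ⊎ YourStrat 𝐎 G

open import Data.Sum using (inj₁; inj₂)

outcome : ∀ Q F → MyStrat Q F → YourStrat Q F → Leaf Q F
outcome Q (var a) _ _ = atom
outcome Q (¬' F) s t = neg (outcome (flip Q) F s t)
outcome 𝐏 (F ∧' G) (s₁ , s₂) (inj₁ t) = ∧l (outcome 𝐏 F s₁ t)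
outcome 𝐏 (F ∧' G) (s₁ , s₂) (inj₂ t) = ∧r (outcome 𝐏 G s₂ t)
outcome 𝐏 (F ∨' G) (inj₁ s) (t₁ , t₂) = ∨l (outcome 𝐏 F s t₁)
outcome 𝐏 (F ∨' G) (inj₂ s) (t₁ , t₂) = ∨r (outcome 𝐏 G s t₂)
outcome 𝐏 (F ×⃗ G) (inj₁ s) (t₁ , t₂) = ×l (outcome 𝐏 F s t₁)
outcome 𝐏 (F ×⃗ G) (inj₂ s) (t₁ , t₂) = ×r (outcome 𝐏 G s t₂)
outcome 𝐎 (F ∧' G) (inj₁ s) (t₁ , t₂) = ∧l (outcome 𝐎 F s t₁)
outcome 𝐎 (F ∧' G) (inj₂ s) (t₁ , t₂) = ∧r (outcome 𝐎 G s t₂)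
outcome 𝐎 (F ∨' G) (s₁ , s₂) (inj₁ t) = ∨l (outcome 𝐎 F s₁ t)
outcome 𝐎 (F ∨' G) (s₁ , s₂) (inj₂ t) = ∨r (outcome 𝐎 G s₂ t)
outcome 𝐎 (F ×⃗ G) (s₁ , s₂) (inj₁ t) = ×l (outcome 𝐎 F s₁ t)
outcome 𝐎 (F ×⃗ G) (s₁ , s₂) (inj₂ t) = ×r (outcome 𝐎 G s₂ t)

Pref : ∀ Q F → Leaf Q F → Leaf Q F → Set
Pref 𝐎 F _ _ = ⊥
Pref 𝐏 (var a) _ _ = ⊥
Pref 𝐏 (¬' F) _ _ = ⊥
Pref 𝐏 (F ∧' G) (∧l x) (∧l y) = Pref 𝐏 F x y
Pref 𝐏 (F ∧' G) (∧r x) (∧r y) = Pref 𝐏 G x y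
Pref 𝐏 (F ∧' G) _ _ = ⊥
Pref 𝐏 (F ∨' G) (∨l x) (∨l y) = Pref 𝐏 F x y
Pref 𝐏 (F ∨' G) (∨r x) (∨r y) = Pref 𝐏 G x y
Pref 𝐏 (F ∨' G) _ _ = ⊥
Pref 𝐏 (F ×⃗ G) (×r x) (×l y) = ⊤
Pref 𝐏 (F ×⃗ G) (×l x) (×l y) = Pref 𝐏 F x y
Pref 𝐏 (F ×⃗ G) (×r x) (×r y) = Pref 𝐏 G x y
Pref 𝐏 (F ×⃗ G) (×l x) (×r y) = ⊥

ChainFrom : ∀ {Q F} → Leaf Q F → List (Leaf Q F) → Set
ChainFrom {Q} {F} o [] = ⊤
ChainFrom {Q} {F} o (o' ∷ os) = Pref Q F o o' × ChainFrom o' os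

ChainLen : ∀ Q F → Leaf Q F → ℕ → Set
ChainLen Q F o n =
  (Σ (List (Leaf Q F)) λ os →
     ChainFrom o os × Unique (o ∷ os) × length (o ∷ os) ≡ n)
  × (∀ (os : List (Leaf Q F)) →
       ChainFrom o os → Unique (o ∷ os) → length (o ∷ os) ≤ n)

leafAtom : ∀ {Q F} → Leaf Q F → Var
leafAtom (atom {a = a}) = a
leafAtom (neg x) = leafAtom x
leafAtom (∧l x) = leafAtom x
leafAtom (∧r x) = leafAtom x
leafAtom (∨l x) = leafAtom x
leafAtom (∨r x) = leafAtom x
leafAtom (×l x) = leafAtom x
leafAtom (×r x) = leafAtom x

leafRole : ∀ {Q F} → Leaf Q F → Role
leafRole (atom {Q = Q}) = Q
leafRole (neg x) = leafRole x
leafRole (∧l x) = leafRole x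
leafRole (∧r x) = leafRole x
leafRole (∨l x) = leafRole x
leafRole (∨r x) = leafRole x
leafRole (×l x) = leafRole x
leafRole (×r x) = leafRole x

roleTrue : Role → Bool → Set
roleTrue 𝐏 b = b ≡ true
roleTrue 𝐎 b = b ≡ false

LeafTrue : Interp → ∀ {Q F} → Leaf Q F → Set
LeafTrue I o = roleTrue (leafRole o) (I (leafAtom o))

data Payoff (I : Interp) (F : Fm) (o : Leaf 𝐏 F) : ℕ∞ → Set where
  payTrue  : ∀ {n} → LeafTrue I o → ChainLen 𝐏 F o n → Payoff I F o (fin n)
  payFalse : ¬ LeafTrue I o → Payoff I F o ∞

-- The value of G(P:F, I) is v, i.e. v = max^≼_{σI} min^≼_{σY} d(σI,σY).
-- Since ≼ is the inverse of the natural order, this says: some σI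
-- guarantees a payoff ≤ v against every σY, and against every σI some σY
-- forces a payoff ≥ v (strategy sets are finite, so max/min are attained).
GameValue : Fm → Interp → ℕ∞ → Set
GameValue F I v =
  (Σ (MyStrat 𝐏 F) λ σI → ∀ (σY : YourStrat 𝐏 F) → ∀ w →
      Payoff I F (outcome 𝐏 F σI σY) w → w ≤∞ v)
  × (∀ (σI : MyStrat 𝐏 F) → Σ (YourStrat 𝐏 F) λ σY → ∀ w →
      Payoff I F (outcome 𝐏 F σI σY) w → v ≤∞ w)

{-# OPTIONS --safe #-}
-- Rank the outcomes of T(P:F) structurally: every leaf has rank 1, except that a right outcome of
-- F ×⃗ G has rank opt F plus its rank in G. Preference strictly lowers the rank, and every outcome
-- starts a ≪-chain of exactly its rank, so |π_≪(O)| = rank O. The value is then computed by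
-- induction on F, together with the fact that the subgame O:F is a pure truth game which I win
-- iff deg F = ∞. At each binary node the player who moves realises the min or max of the clause
-- for deg; at P:F ×⃗ G I move right only when deg F = ∞, and then pay opt F more than in G.
module Submission where

open import Defs
open import Data.Nat using (ℕ; suc; _+_; _≤_; _<_; s≤s)
open import Data.Nat.Properties
open import Data.Bool using (Bool; true; false; not; if_then_else_)
open import Data.Product using (_×_; Σ; _,_; proj₁; proj₂)
open import Data.Sum using (_⊎_; inj₁; inj₂; [_,_])
open import Data.Unit using (tt)
open import Data.Empty using (⊥-elim)
open import Data.List using (List; []; _∷_; length; map; _++_)
open import Data.List.Properties using (length-map; length-++)
open import Data.List.Relation.Unary.All using (All; []; _∷_)
import Data.List.Relation.Unary.All as All
open import Data.List.Relation.Unary.AllPairs using ([]; _∷_)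
open import Data.List.Relation.Unary.Unique.Propositional using (Unique)
open import Function using (_∘_)
open import Relation.Binary.PropositionalEquality hiding ([_])
open import Relation.Nullary using (¬_)

private variable
  Q : Role
  F G : Fm
  k m n : ℕ
  x y : ℕ∞

≤∞-refl : x ≤∞ x
≤∞-refl {fin n} = fin≤fin ≤-refl
≤∞-refl {∞} = ≤∞-top

≤∞-reflexive : x ≡ y → x ≤∞ y
≤∞-reflexive refl = ≤∞-refl

≤∞-trans : ∀ {z} → x ≤∞ y → y ≤∞ z → x ≤∞ z
≤∞-trans (fin≤fin p) (fin≤fin q) = fin≤fin (≤-trans p q)
≤∞-trans _ ≤∞-top = ≤∞-top

fin≤fin⁻¹ : fin m ≤∞ fin n → m ≤ n
fin≤fin⁻¹ (fin≤fin p) = p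

∞≤∞⇒top : ∞ ≤∞ x → y ≤∞ x
∞≤∞⇒top ≤∞-top = ≤∞-top

x≤∞max∞xy : ∀ x y → x ≤∞ max∞ x y
x≤∞max∞xy (fin m) (fin n) = fin≤fin (m≤m⊔n m n)
x≤∞max∞xy (fin m) ∞ = ≤∞-top
x≤∞max∞xy ∞ y = ≤∞-top

y≤∞max∞xy : ∀ x y → y ≤∞ max∞ x y
y≤∞max∞xy (fin m) (fin n) = fin≤fin (m≤n⊔m m n)
y≤∞max∞xy (fin m) ∞ = ≤∞-top
y≤∞max∞xy ∞ y = ≤∞-top

max∞-sel : ∀ x y → max∞ x y ≡ x ⊎ max∞ x y ≡ y
max∞-sel (fin m) (fin n) = Data.Sum.map (cong fin) (cong fin) (⊔-sel m n)
max∞-sel (fin m) ∞ = inj₂ refl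
max∞-sel ∞ y = inj₁ refl

min∞xy≤∞x : ∀ x y → min∞ x y ≤∞ x
min∞xy≤∞x (fin m) (fin n) = fin≤fin (m⊓n≤m m n)
min∞xy≤∞x (fin m) ∞ = ≤∞-refl
min∞xy≤∞x ∞ y = ≤∞-top

min∞xy≤∞y : ∀ x y → min∞ x y ≤∞ y
min∞xy≤∞y (fin m) (fin n) = fin≤fin (m⊓n≤n m n)
min∞xy≤∞y (fin m) ∞ = ≤∞-top
min∞xy≤∞y ∞ y = ≤∞-refl

min∞-sel : ∀ x y → min∞ x y ≡ x ⊎ min∞ x y ≡ y
min∞-sel (fin m) (fin n) = Data.Sum.map (cong fin) (cong fin) (⊓-sel m n)
min∞-sel (fin m) ∞ = inj₁ refl
min∞-sel ∞ y = inj₂ refl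

infixl 30 _+∞_

_+∞_ : ℕ → ℕ∞ → ℕ∞
k +∞ fin n = fin (k + n)
k +∞ ∞ = ∞

+∞-monoʳ-≤∞ : ∀ k → x ≤∞ y → k +∞ x ≤∞ k +∞ y
+∞-monoʳ-≤∞ k (fin≤fin p) = fin≤fin (+-monoʳ-≤ k p)
+∞-monoʳ-≤∞ k ≤∞-top = ≤∞-top

m≤∞m+∞x : ∀ k x → fin k ≤∞ k +∞ x
m≤∞m+∞x k (fin n) = fin≤fin (m≤m+n k n)
m≤∞m+∞x k ∞ = ≤∞-top

anyLeaf : ∀ Q F → Leaf Q F
anyLeaf Q (var a) = atom
anyLeaf Q (¬' F) = neg (anyLeaf (flip Q) F)
anyLeaf Q (F ∧' G) = ∧l (anyLeaf Q F)
anyLeaf Q (F ∨' G) = ∨l (anyLeaf Q F)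
anyLeaf Q (F ×⃗ G) = ×l (anyLeaf Q F)

anyMyStrat : ∀ Q F → MyStrat Q F
anyYourStrat : ∀ Q F → YourStrat Q F
anyMyStrat Q (var a) = tt
anyMyStrat Q (¬' F) = anyMyStrat (flip Q) F
anyMyStrat 𝐏 (F ∧' G) = anyMyStrat 𝐏 F , anyMyStrat 𝐏 G
anyMyStrat 𝐏 (F ∨' G) = inj₁ (anyMyStrat 𝐏 F)
anyMyStrat 𝐏 (F ×⃗ G) = inj₁ (anyMyStrat 𝐏 F)
anyMyStrat 𝐎 (F ∧' G) = inj₁ (anyMyStrat 𝐎 F)
anyMyStrat 𝐎 (F ∨' G) = anyMyStrat 𝐎 F , anyMyStrat 𝐎 G
anyMyStrat 𝐎 (F ×⃗ G) = anyMyStrat 𝐎 F , anyMyStrat 𝐎 G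
anyYourStrat Q (var a) = tt
anyYourStrat Q (¬' F) = anyYourStrat (flip Q) F
anyYourStrat 𝐏 (F ∧' G) = inj₁ (anyYourStrat 𝐏 F)
anyYourStrat 𝐏 (F ∨' G) = anyYourStrat 𝐏 F , anyYourStrat 𝐏 G
anyYourStrat 𝐏 (F ×⃗ G) = anyYourStrat 𝐏 F , anyYourStrat 𝐏 G
anyYourStrat 𝐎 (F ∧' G) = anyYourStrat 𝐎 F , anyYourStrat 𝐎 G
anyYourStrat 𝐎 (F ∨' G) = inj₁ (anyYourStrat 𝐎 F)
anyYourStrat 𝐎 (F ×⃗ G) = inj₁ (anyYourStrat 𝐎 F)

rank : Leaf 𝐏 F → ℕ
rank atom = 1
rank (neg o) = 1
rank (∧l o) = rank o
rank (∧r o) = rank o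
rank (∨l o) = rank o
rank (∨r o) = rank o
rank (×l o) = rank o
rank {F ×⃗ G} (×r o) = opt F + rank o

1≤rank : (o : Leaf 𝐏 F) → 1 ≤ rank o
1≤rank atom = ≤-refl
1≤rank (neg o) = ≤-refl
1≤rank (∧l o) = 1≤rank o
1≤rank (∧r o) = 1≤rank o
1≤rank (∨l o) = 1≤rank o
1≤rank (∨r o) = 1≤rank o
1≤rank (×l o) = 1≤rank o
1≤rank {F ×⃗ G} (×r o) = ≤-trans (1≤rank o) (m≤n+m (rank o) (opt F))

rank≤opt : (o : Leaf 𝐏 F) → rank o ≤ opt F
rank≤opt atom = ≤-refl
rank≤opt (neg o) = ≤-refl
rank≤opt {F ∧' G} (∧l o) = ≤-trans (rank≤opt o) (m≤m⊔n (opt F) (opt G))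
rank≤opt {F ∧' G} (∧r o) = ≤-trans (rank≤opt o) (m≤n⊔m (opt F) (opt G))
rank≤opt {F ∨' G} (∨l o) = ≤-trans (rank≤opt o) (m≤m⊔n (opt F) (opt G))
rank≤opt {F ∨' G} (∨r o) = ≤-trans (rank≤opt o) (m≤n⊔m (opt F) (opt G))
rank≤opt {F ×⃗ G} (×l o) = ≤-trans (rank≤opt o) (m≤m+n (opt F) (opt G))
rank≤opt {F ×⃗ G} (×r o) = +-monoʳ-≤ (opt F) (rank≤opt o)

topLeaf : ∀ F → Σ (Leaf 𝐏 F) λ t → rank t ≡ opt F
topLeaf (var a) = atom , refl
topLeaf (¬' F) = neg (anyLeaf 𝐎 F) , refl
topLeaf (F ∧' G) with ⊔-sel (opt F) (opt G) | topLeaf F | topLeaf G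
... | inj₁ e | t , r | _ = ∧l t , trans r (sym e)
... | inj₂ e | _ | t , r = ∧r t , trans r (sym e)
topLeaf (F ∨' G) with ⊔-sel (opt F) (opt G) | topLeaf F | topLeaf G
... | inj₁ e | t , r | _ = ∨l t , trans r (sym e)
... | inj₂ e | _ | t , r = ∨r t , trans r (sym e)
topLeaf (F ×⃗ G) with topLeaf G
... | t , r = ×r t , cong (opt F +_) r

Pref⇒rank> : (o o′ : Leaf 𝐏 F) → Pref 𝐏 F o o′ → rank o′ < rank o
Pref⇒rank> (∧l o) (∧l o′) p = Pref⇒rank> o o′ p
Pref⇒rank> (∧r o) (∧r o′) p = Pref⇒rank> o o′ p
Pref⇒rank> (∨l o) (∨l o′) p = Pref⇒rank> o o′ p
Pref⇒rank> (∨r o) (∨r o′) p = Pref⇒rank> o o′ p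
Pref⇒rank> (×l o) (×l o′) p = Pref⇒rank> o o′ p
Pref⇒rank> {F ×⃗ G} (×r o) (×r o′) p = +-monoʳ-< (opt F) (Pref⇒rank> o o′ p)
Pref⇒rank> {F ×⃗ G} (×r o) (×l o′) p = ≤-<-trans (rank≤opt o′) (m<m+n (opt F) (1≤rank o))

chain-length≤rank : (o : Leaf 𝐏 F) (os : List (Leaf 𝐏 F)) →
                    ChainFrom o os → length (o ∷ os) ≤ rank o
chain-length≤rank o [] _ = 1≤rank o
chain-length≤rank o (o′ ∷ os) (p , c) =
  ≤-trans (s≤s (chain-length≤rank o′ os c)) (Pref⇒rank> o o′ p)

chain-below : (o : Leaf 𝐏 F) (os : List (Leaf 𝐏 F)) →
              ChainFrom o os → All (λ o′ → rank o′ < rank o) os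
chain-below o [] _ = []
chain-below o (o′ ∷ os) (p , c) =
  Pref⇒rank> o o′ p ∷ All.map (λ q → <-trans q (Pref⇒rank> o o′ p)) (chain-below o′ os c)

chain-unique : (o : Leaf 𝐏 F) (os : List (Leaf 𝐏 F)) → ChainFrom o os → Unique (o ∷ os)
chain-unique o [] _ = [] ∷ []
chain-unique o (o′ ∷ os) (p , c) =
  All.map (λ q o≡o″ → <-irrefl (cong rank (sym o≡o″)) q) (chain-below o (o′ ∷ os) (p , c))
  ∷ chain-unique o′ os c

ChainOfLength : Leaf 𝐏 F → ℕ → Set
ChainOfLength {F} o n = Σ (List (Leaf 𝐏 F)) λ os → ChainFrom o os × length (o ∷ os) ≡ n

map-chain : (f : Leaf 𝐏 F → Leaf 𝐏 G) →
            (∀ {o o′} → Pref 𝐏 F o o′ → Pref 𝐏 G (f o) (f o′)) →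
            ∀ {o} os → ChainFrom o os → ChainFrom (f o) (map f os)
map-chain f f-mono [] _ = tt
map-chain f f-mono (o′ ∷ os) (p , c) = f-mono p , map-chain f f-mono os c

map-chainOfLength : (f : Leaf 𝐏 F → Leaf 𝐏 G) →
                    (∀ {o o′} → Pref 𝐏 F o o′ → Pref 𝐏 G (f o) (f o′)) →
                    ∀ {o} → ChainOfLength o n → ChainOfLength (f o) n
map-chainOfLength f f-mono (os , c , e) =
  map f os , map-chain f f-mono os c , trans (cong suc (length-map f os)) e

chain-×r-++-×l : ∀ {o : Leaf 𝐏 G} {t : Leaf 𝐏 F} os ts →
  ChainFrom (×r {F = F} o) (map ×r os) → ChainFrom (×l {G = G} t) ts →
  ChainFrom (×r o) (map ×r os ++ ×l t ∷ ts)
chain-×r-++-×l [] ts _ c = tt , c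
chain-×r-++-×l (o′ ∷ os) ts (p , c₁) c₂ = p , chain-×r-++-×l os ts c₁ c₂

-- Every right outcome of F ×⃗ G is ≪-below every left one, so a chain in G continues into F.
chainOfLength-×r-×l : ∀ {o : Leaf 𝐏 G} {t : Leaf 𝐏 F} →
  ChainOfLength o m → ChainOfLength t n → ChainOfLength (×r {F = F} o) (m + n)
chainOfLength-×r-×l {o = o} {t} (os , c , e) (ts , d , e′) =
  map ×r os ++ ×l t ∷ map ×l ts ,
  chain-×r-++-×l os (map ×l ts) (map-chain ×r (λ p → p) os c) (map-chain ×l (λ p → p) ts d) ,
  (begin
    suc (length (map ×r os ++ ×l t ∷ map ×l ts))    ≡⟨ cong suc (length-++ (map ×r os)) ⟩
    suc (length (map ×r os) + suc (length (map ×l ts)))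
      ≡⟨ cong₂ (λ i j → suc (i + suc j)) (length-map ×r os) (length-map ×l ts) ⟩
    suc (length os) + suc (length ts)                 ≡⟨ cong₂ _+_ e e′ ⟩
    _ ∎)
  where open ≡-Reasoning

rank-chain : (o : Leaf 𝐏 F) → ChainOfLength o (rank o)
rank-chain atom = [] , tt , refl
rank-chain (neg o) = [] , tt , refl
rank-chain (∧l o) = map-chainOfLength ∧l (λ p → p) (rank-chain o)
rank-chain (∧r o) = map-chainOfLength ∧r (λ p → p) (rank-chain o)
rank-chain (∨l o) = map-chainOfLength ∨l (λ p → p) (rank-chain o)
rank-chain (∨r o) = map-chainOfLength ∨r (λ p → p) (rank-chain o)
rank-chain (×l o) = map-chainOfLength ×l (λ p → p) (rank-chain o)
rank-chain {F ×⃗ G} (×r o) with topLeaf F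
... | t , rank-t≡opt =
  subst (ChainOfLength (×r o)) (trans (cong (rank o +_) rank-t≡opt) (+-comm (rank o) (opt F)))
    (chainOfLength-×r-×l (rank-chain o) (rank-chain t))

chainLen-rank : (o : Leaf 𝐏 F) → ChainLen 𝐏 F o (rank o)
chainLen-rank o with rank-chain o
... | os , c , e = (os , c , chain-unique o os c , e) , λ os′ c′ _ → chain-length≤rank o os′ c′

ChainLen-unique : ∀ {o : Leaf Q F} → ChainLen Q F o m → ChainLen Q F o n → m ≡ n
ChainLen-unique ((os , c , u , refl) , bound-m) ((os′ , c′ , u′ , refl) , bound-n) =
  ≤-antisym (bound-n os c u) (bound-m os′ c′ u′)

record IForce (Q : Role) (F : Fm) (P : Leaf Q F → Set) : Set where
  constructor forcing
  field
    strategy : MyStrat Q F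
    forced   : ∀ σY → P (outcome Q F strategy σY)

record YouForce (Q : Role) (F : Fm) (P : Leaf Q F → Set) : Set where
  constructor countering
  field
    counter : MyStrat Q F → YourStrat Q F
    forced  : ∀ σI → P (outcome Q F σI (counter σI))

module _ {P : Leaf Q F → Set} where

  IForce-everywhere : (∀ o → P o) → IForce Q F P
  IForce-everywhere h = forcing (anyMyStrat Q F) (λ _ → h _)

  YouForce-everywhere : (∀ o → P o) → YouForce Q F P
  YouForce-everywhere h = countering (λ _ → anyYourStrat Q F) (λ _ → h _)

module _ {P R : Leaf Q F → Set} where

  IForce-map : (∀ {o} → P o → R o) → IForce Q F P → IForce Q F R
  IForce-map f (forcing σI h) = forcing σI (f ∘ h)

  YouForce-map : (∀ {o} → P o → R o) → YouForce Q F P → YouForce Q F R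
  YouForce-map f (countering c h) = countering c (f ∘ h)

  saddle : IForce Q F P → YouForce Q F R → Σ (Leaf Q F) λ o → P o × R o
  saddle (forcing σI h) (countering c k) = _ , h (c σI) , k σI

IForce-¬ : ∀ {P : Leaf Q (¬' F) → Set} → IForce (flip Q) F (P ∘ neg) → IForce Q (¬' F) P
IForce-¬ (forcing σI h) = forcing σI h

YouForce-¬ : ∀ {P : Leaf Q (¬' F) → Set} → YouForce (flip Q) F (P ∘ neg) → YouForce Q (¬' F) P
YouForce-¬ (countering c h) = countering c h

module _ {F G : Fm} where

  module _ {P : Leaf 𝐏 (F ∧' G) → Set} where

    IForce-∧𝐏 : IForce 𝐏 F (P ∘ ∧l) → IForce 𝐏 G (P ∘ ∧r) → IForce 𝐏 (F ∧' G) P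
    IForce-∧𝐏 (forcing σ₁ h₁) (forcing σ₂ h₂) = forcing (σ₁ , σ₂) [ h₁ , h₂ ]

    YouForce-∧𝐏ˡ : YouForce 𝐏 F (P ∘ ∧l) → YouForce 𝐏 (F ∧' G) P
    YouForce-∧𝐏ˡ (countering c h) = countering (inj₁ ∘ c ∘ proj₁) (h ∘ proj₁)

    YouForce-∧𝐏ʳ : YouForce 𝐏 G (P ∘ ∧r) → YouForce 𝐏 (F ∧' G) P
    YouForce-∧𝐏ʳ (countering c h) = countering (inj₂ ∘ c ∘ proj₂) (h ∘ proj₂)

  module _ {P : Leaf 𝐏 (F ∨' G) → Set} where

    IForce-∨𝐏ˡ : IForce 𝐏 F (P ∘ ∨l) → IForce 𝐏 (F ∨' G) P
    IForce-∨𝐏ˡ (forcing σ h) = forcing (inj₁ σ) (h ∘ proj₁)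

    IForce-∨𝐏ʳ : IForce 𝐏 G (P ∘ ∨r) → IForce 𝐏 (F ∨' G) P
    IForce-∨𝐏ʳ (forcing σ h) = forcing (inj₂ σ) (h ∘ proj₂)

    YouForce-∨𝐏 : YouForce 𝐏 F (P ∘ ∨l) → YouForce 𝐏 G (P ∘ ∨r) → YouForce 𝐏 (F ∨' G) P
    YouForce-∨𝐏 (countering c₁ h₁) (countering c₂ h₂) =
      countering [ (λ σ → c₁ σ , anyYourStrat 𝐏 G) , (λ σ → anyYourStrat 𝐏 F , c₂ σ) ]
                 [ h₁ , h₂ ]

  module _ {P : Leaf 𝐏 (F ×⃗ G) → Set} where

    IForce-×𝐏ˡ : IForce 𝐏 F (P ∘ ×l) → IForce 𝐏 (F ×⃗ G) P
    IForce-×𝐏ˡ (forcing σ h) = forcing (inj₁ σ) (h ∘ proj₁)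

    IForce-×𝐏ʳ : IForce 𝐏 G (P ∘ ×r) → IForce 𝐏 (F ×⃗ G) P
    IForce-×𝐏ʳ (forcing σ h) = forcing (inj₂ σ) (h ∘ proj₂)

    YouForce-×𝐏 : YouForce 𝐏 F (P ∘ ×l) → YouForce 𝐏 G (P ∘ ×r) → YouForce 𝐏 (F ×⃗ G) P
    YouForce-×𝐏 (countering c₁ h₁) (countering c₂ h₂) =
      countering [ (λ σ → c₁ σ , anyYourStrat 𝐏 G) , (λ σ → anyYourStrat 𝐏 F , c₂ σ) ]
                 [ h₁ , h₂ ]

  module _ {P : Leaf 𝐎 (F ∧' G) → Set} where

    IForce-∧𝐎ˡ : IForce 𝐎 F (P ∘ ∧l) → IForce 𝐎 (F ∧' G) P
    IForce-∧𝐎ˡ (forcing σ h) = forcing (inj₁ σ) (h ∘ proj₁)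

    IForce-∧𝐎ʳ : IForce 𝐎 G (P ∘ ∧r) → IForce 𝐎 (F ∧' G) P
    IForce-∧𝐎ʳ (forcing σ h) = forcing (inj₂ σ) (h ∘ proj₂)

    YouForce-∧𝐎 : YouForce 𝐎 F (P ∘ ∧l) → YouForce 𝐎 G (P ∘ ∧r) → YouForce 𝐎 (F ∧' G) P
    YouForce-∧𝐎 (countering c₁ h₁) (countering c₂ h₂) =
      countering [ (λ σ → c₁ σ , anyYourStrat 𝐎 G) , (λ σ → anyYourStrat 𝐎 F , c₂ σ) ]
                 [ h₁ , h₂ ]

  module _ {P : Leaf 𝐎 (F ∨' G) → Set} where

    IForce-∨𝐎 : IForce 𝐎 F (P ∘ ∨l) → IForce 𝐎 G (P ∘ ∨r) → IForce 𝐎 (F ∨' G) P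
    IForce-∨𝐎 (forcing σ₁ h₁) (forcing σ₂ h₂) = forcing (σ₁ , σ₂) [ h₁ , h₂ ]

    YouForce-∨𝐎ˡ : YouForce 𝐎 F (P ∘ ∨l) → YouForce 𝐎 (F ∨' G) P
    YouForce-∨𝐎ˡ (countering c h) = countering (inj₁ ∘ c ∘ proj₁) (h ∘ proj₁)

    YouForce-∨𝐎ʳ : YouForce 𝐎 G (P ∘ ∨r) → YouForce 𝐎 (F ∨' G) P
    YouForce-∨𝐎ʳ (countering c h) = countering (inj₂ ∘ c ∘ proj₂) (h ∘ proj₂)

  module _ {P : Leaf 𝐎 (F ×⃗ G) → Set} where

    IForce-×𝐎 : IForce 𝐎 F (P ∘ ×l) → IForce 𝐎 G (P ∘ ×r) → IForce 𝐎 (F ×⃗ G) P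
    IForce-×𝐎 (forcing σ₁ h₁) (forcing σ₂ h₂) = forcing (σ₁ , σ₂) [ h₁ , h₂ ]

    YouForce-×𝐎ˡ : YouForce 𝐎 F (P ∘ ×l) → YouForce 𝐎 (F ×⃗ G) P
    YouForce-×𝐎ˡ (countering c h) = countering (inj₁ ∘ c ∘ proj₁) (h ∘ proj₁)

    YouForce-×𝐎ʳ : YouForce 𝐎 G (P ∘ ×r) → YouForce 𝐎 (F ×⃗ G) P
    YouForce-×𝐎ʳ (countering c h) = countering (inj₂ ∘ c ∘ proj₂) (h ∘ proj₂)

holds : Role → Bool → Bool
holds 𝐏 b = b
holds 𝐎 b = not b

roleTrue⇒holds : ∀ Q {b} → roleTrue Q b → holds Q b ≡ true
roleTrue⇒holds 𝐏 refl = refl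
roleTrue⇒holds 𝐎 refl = refl

¬roleTrue⇒¬holds : ∀ Q b → ¬ roleTrue Q b → holds Q b ≡ false
¬roleTrue⇒¬holds 𝐏 true ¬t = ⊥-elim (¬t refl)
¬roleTrue⇒¬holds 𝐏 false _ = refl
¬roleTrue⇒¬holds 𝐎 true _ = refl
¬roleTrue⇒¬holds 𝐎 false ¬t = ⊥-elim (¬t refl)

module _ (I : Interp) where

  truth : Leaf Q F → Bool
  truth o = holds (leafRole o) (I (leafAtom o))

  payoff : Leaf 𝐏 F → ℕ∞
  payoff o = if truth o then fin (rank o) else ∞

  Payoff⇒payoff : ∀ {o : Leaf 𝐏 F} {w} → Payoff I F o w → w ≡ payoff o
  Payoff⇒payoff {o = o} (payTrue t len) rewrite roleTrue⇒holds (leafRole o) t =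
    cong fin (ChainLen-unique len (chainLen-rank o))
  Payoff⇒payoff {o = o} (payFalse ¬t) rewrite ¬roleTrue⇒¬holds (leafRole o) _ ¬t = refl

  payoff-true : (o : Leaf 𝐏 F) → truth o ≡ true → payoff o ≡ fin (rank o)
  payoff-true o t rewrite t = refl

  payoff-false : (o : Leaf 𝐏 F) → truth o ≡ false → payoff o ≡ ∞
  payoff-false o f rewrite f = refl

  payoff≤fin⇒true : (o : Leaf 𝐏 F) → payoff o ≤∞ fin k → truth o ≡ true
  payoff≤fin⇒true o p with truth o
  ... | true = refl

  ∞≤payoff⇒false : (o : Leaf 𝐏 F) → ∞ ≤∞ payoff o → truth o ≡ false
  ∞≤payoff⇒false o p with truth o
  ... | false = refl

  1≤payoff : (o : Leaf 𝐏 F) → fin 1 ≤∞ payoff o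
  1≤payoff o with truth o
  ... | true = fin≤fin (1≤rank o)
  ... | false = ≤∞-top

  payoff-×r : (o : Leaf 𝐏 G) → payoff (×r {F = F} o) ≡ opt F +∞ payoff o
  payoff-×r o with truth o
  ... | true = refl
  ... | false = refl

  module _ (F : Fm) (o : Leaf 𝐏 G) where

    payoff-×r-≤∞ : payoff o ≤∞ x → payoff (×r {F = F} o) ≤∞ opt F +∞ x
    payoff-×r-≤∞ p = ≤∞-trans (≤∞-reflexive (payoff-×r {F = F} o)) (+∞-monoʳ-≤∞ (opt F) p)

    ≤∞-payoff-×r : x ≤∞ payoff o → opt F +∞ x ≤∞ payoff (×r {F = F} o)
    ≤∞-payoff-×r p = ≤∞-trans (+∞-monoʳ-≤∞ (opt F) p) (≤∞-reflexive (sym (payoff-×r {F = F} o)))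

    opt≤payoff-×r : fin (opt F) ≤∞ payoff (×r {F = F} o)
    opt≤payoff-×r =
      ≤∞-trans (m≤∞m+∞x (opt F) (payoff o)) (≤∞-reflexive (sym (payoff-×r {F = F} o)))

  Value𝐏 : ∀ F → ℕ∞ → Set
  Value𝐏 F v = IForce 𝐏 F (λ o → payoff o ≤∞ v) × YouForce 𝐏 F (λ o → v ≤∞ payoff o)

  -- Below a negation every outcome has rank 1, so only the truth of the outcome of O:F matters.
  Verdict𝐎 : ∀ F → ℕ∞ → Set
  Verdict𝐎 F ∞ = IForce 𝐎 F (λ o → truth o ≡ true)
  Verdict𝐎 F (fin _) = YouForce 𝐎 F (λ o → truth o ≡ false)

  -- A value is attained as the payoff of some outcome, and finite payoffs are ranks ≤ opt F.
  Value𝐏⇒≤opt : Value𝐏 F (fin m) → m ≤ opt F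
  Value𝐏⇒≤opt (me , you) with saddle me you
  ... | o , o≤m , m≤o =
    ≤-trans (fin≤fin⁻¹ (subst (fin _ ≤∞_) (payoff-true o (payoff≤fin⇒true o o≤m)) m≤o))
            (rank≤opt o)

  value𝐏 : ∀ F → Value𝐏 F (deg I F)
  verdict𝐎 : ∀ F → Verdict𝐎 F (deg I F)

  value𝐏 (var a) =
    IForce-everywhere (λ { atom → ≤∞-refl }) , YouForce-everywhere (λ { atom → ≤∞-refl })
  value𝐏 (¬' F) with deg I F | verdict𝐎 F
  ... | fin _ | youFalsify =
    IForce-everywhere (λ _ → ≤∞-top) ,
    YouForce-¬ (YouForce-map (λ {o} f → ≤∞-reflexive (sym (payoff-false (neg o) f))) youFalsify)
  ... | ∞ | iVerify =
    IForce-¬ (IForce-map (λ {o} t → ≤∞-reflexive (payoff-true (neg o) t)) iVerify) ,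
    YouForce-everywhere 1≤payoff
  value𝐏 (F ∧' G) with value𝐏 F | value𝐏 G | max∞-sel (deg I F) (deg I G)
  ... | me₁ , you₁ | me₂ , you₂ | sel =
    IForce-∧𝐏 (IForce-map (λ p → ≤∞-trans p (x≤∞max∞xy _ _)) me₁)
              (IForce-map (λ p → ≤∞-trans p (y≤∞max∞xy _ _)) me₂) ,
    [ (λ e → YouForce-∧𝐏ˡ (YouForce-map (≤∞-trans (≤∞-reflexive e)) you₁))
    , (λ e → YouForce-∧𝐏ʳ (YouForce-map (≤∞-trans (≤∞-reflexive e)) you₂)) ] sel
  value𝐏 (F ∨' G) with value𝐏 F | value𝐏 G | min∞-sel (deg I F) (deg I G)
  ... | me₁ , you₁ | me₂ , you₂ | sel =
    [ (λ e → IForce-∨𝐏ˡ (IForce-map (λ p → ≤∞-trans p (≤∞-reflexive (sym e))) me₁))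
    , (λ e → IForce-∨𝐏ʳ (IForce-map (λ p → ≤∞-trans p (≤∞-reflexive (sym e))) me₂)) ] sel ,
    YouForce-∨𝐏 (YouForce-map (≤∞-trans (min∞xy≤∞x _ _)) you₁)
                (YouForce-map (≤∞-trans (min∞xy≤∞y _ _)) you₂)
  value𝐏 (F ×⃗ G) with deg I F | deg I G | value𝐏 F | value𝐏 G
  ... | fin m | _ | valueF@(me₁ , you₁) | _ =
    IForce-×𝐏ˡ me₁ ,
    YouForce-×𝐏 you₁
      (YouForce-everywhere (λ o → ≤∞-trans (fin≤fin (Value𝐏⇒≤opt valueF)) (opt≤payoff-×r F o)))
  ... | ∞ | fin n | _ , you₁ | me₂ , you₂ =
    IForce-×𝐏ʳ (IForce-map (λ {o} → payoff-×r-≤∞ F o) me₂) ,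
    YouForce-×𝐏 (YouForce-map ∞≤∞⇒top you₁) (YouForce-map (λ {o} → ≤∞-payoff-×r F o) you₂)
  ... | ∞ | ∞ | _ , you₁ | _ , you₂ =
    IForce-everywhere (λ _ → ≤∞-top) ,
    YouForce-×𝐏 you₁ (YouForce-map (λ {o} → ≤∞-payoff-×r F o) you₂)

  verdict𝐎 (var a) with I a in a∈I
  ... | true = YouForce-everywhere (λ { atom → cong not a∈I })
  ... | false = IForce-everywhere (λ { atom → cong not a∈I })
  verdict𝐎 (¬' F) with deg I F | value𝐏 F
  ... | fin _ | me , _ = IForce-¬ (IForce-map (λ {o} → payoff≤fin⇒true o) me)
  ... | ∞ | _ , you = YouForce-¬ (YouForce-map (λ {o} → ∞≤payoff⇒false o) you)
  verdict𝐎 (F ∧' G) with deg I F | deg I G | verdict𝐎 F | verdict𝐎 G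
  ... | fin _ | fin _ | you₁ | you₂ = YouForce-∧𝐎 you₁ you₂
  ... | fin _ | ∞ | _ | me₂ = IForce-∧𝐎ʳ me₂
  ... | ∞ | _ | me₁ | _ = IForce-∧𝐎ˡ me₁
  verdict𝐎 (F ∨' G) with deg I F | deg I G | verdict𝐎 F | verdict𝐎 G
  ... | fin _ | fin _ | you₁ | _ = YouForce-∨𝐎ˡ you₁
  ... | fin _ | ∞ | you₁ | _ = YouForce-∨𝐎ˡ you₁
  ... | ∞ | fin _ | _ | you₂ = YouForce-∨𝐎ʳ you₂
  ... | ∞ | ∞ | me₁ | me₂ = IForce-∨𝐎 me₁ me₂
  verdict𝐎 (F ×⃗ G) with deg I F | deg I G | verdict𝐎 F | verdict𝐎 G
  ... | fin _ | _ | you₁ | _ = YouForce-×𝐎ˡ you₁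
  ... | ∞ | fin _ | _ | you₂ = YouForce-×𝐎ʳ you₂
  ... | ∞ | ∞ | me₁ | me₂ = IForce-×𝐎 me₁ me₂

theorem1 : ∀ (F : Fm) (I : Interp) → GameValue F I (deg I F)
theorem1 F I with value𝐏 I F
... | forcing σI me , countering counter you =
  (σI , λ σY w p → subst (_≤∞ deg I F) (sym (Payoff⇒payoff I p)) (me σY)) ,
  λ σI′ → counter σI′ , λ w p → subst (deg I F ≤∞_) (sym (Payoff⇒payoff I p)) (you σI′)
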